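{- Let $n\geq 1$, let $\mathcal{C}$ be a finite set, and let $\{\varphi_i\mid 2\leq i\leq n-1\}$ be involutions on $\mathcal{C}$. Let $\mathcal{G}$ be the graph with vertex set $\mathcal{C}$ having an edge of color $i$ between $c$ and $\varphi_i(c)$ whenever $c\neq\varphi_i(c)$. Suppose $D,D'\colon\mathcal{C}\to 2^{[n-1]}$ are two maps such that, with respect to each of $D$ and $D'$ (used as the descent map), the involutions satisfy conditions (i) and (ii.b) below. Then on every connected component $K$ of $\mathcal{G}$, either $D'(c)=D(c)$ for all $c\in K$, or $D'(c)=[n-1]\setminus D(c)$ for all $c\in K$. In other words, the colored edges in a connected component determine the descent sets of its vertices up to a global complementation.
   Context: $[n-1]=\{1,\dotsc,n-1\}$. For a map $\mathrm{Des}\colon\mathcal{C}\to 2^{[n-1]}$, say $c$ has a descent at $j$ if $j\in\mathrm{Des}(c)$. Condition (i): for each $2\leq i\leq n-1$, the fixed points of $\varphi_i$ are exactly those $c\in\mathcal{C}$ which either have descents at both $i-1$ and $i$, or have a descent at neither $i-1$ nor $i$. Condition (ii.b): for each $2\leq i\leq n-1$ and each $c$ with $c\neq\varphi_i(c)$, for each $j\in\{i-1,i\}$ exactly one of $c$ and $\varphi_i(c)$ has a descent at $j$. -}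

module Defs where

open import Data.Nat using (ℕ; zero; suc; _≤_; _<_; _∸_)
open import Data.Bool using (Bool; false)
open import Data.Vec using ([]; _∷_)
open import Data.Fin.Subset using (Subset)
open import Data.Product using (Σ; _×_)
open import Relation.Binary.PropositionalEquality using (_≡_; _≢_)
open import Relation.Binary.Construct.Closure.ReflexiveTransitive using (Star)
open import Function using (_⇔_)

-- [n-1] = {1,…,n-1}; a subset of [n-1] is a Subset (n ∸ 1), whose
-- position p (0-based) encodes the element p+1.
-- desAt S j : does S contain j (for 1 ≤ j ≤ k; false outside that range)
desAt : ∀ {k} → Subset k → ℕ → Bool
desAt [] _ = false
desAt (b ∷ S) zero = false
desAt (b ∷ S) (suc zero) = b
desAt (b ∷ S) (suc (suc j)) = desAt S (suc j)

module _ {C : Set} (n : ℕ) (φ : ℕ → C → C) where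

  Colour : ℕ → Set
  Colour i = (2 ≤ i) × (i < n)

  Involutions : Set
  Involutions = ∀ i → Colour i → ∀ c → φ i (φ i c) ≡ c

  Edge : C → C → Set
  Edge c d = Σ ℕ λ i → Colour i × (φ i c ≡ d) × (c ≢ d)

  Connected : C → C → Set
  Connected = Star Edge

  CondI : (C → Subset (n ∸ 1)) → Set
  CondI Des = ∀ i → Colour i → ∀ c →
    (φ i c ≡ c) ⇔ (desAt (Des c) (i ∸ 1) ≡ desAt (Des c) i)

  -- Condition (ii.b) w.r.t. the descent map Des
  -- (for booleans, "exactly one of c, φ_i c has a descent at j" is ≢)
  CondIIb : (C → Subset (n ∸ 1)) → Set
  CondIIb Des = ∀ i → Colour i → ∀ c → c ≢ φ i c →
    (desAt (Des c) (i ∸ 1) ≢ desAt (Des (φ i c)) (i ∸ 1)) ×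
    (desAt (Des c) i ≢ desAt (Des (φ i c)) i)

module Submission where

-- By condition (i), φ_i fixes c exactly when D(c) has equal entries at i-1 and i,
-- so D(c) and D′(c) have equal entries at the same consecutive positions, which
-- forces D′(c) = D(c) or D′(c) = ∁ D(c). Along an edge c — φ_i(c), condition (ii.b)
-- makes both D and D′ change their entry at i, and this rules out D′ = D at one end
-- and D′ = ∁ D at the other; so the alternative chosen at c₀ spreads over the component.

open import Defs
open import Data.Nat using (ℕ; zero; suc; _≤_; _<_; _∸_; z≤n; s≤s)
open import Data.Nat.Properties using (∸-monoˡ-≤)
open import Data.Bool using (Bool; true; false; not; _≟_)
open import Data.Bool.Properties using (¬-not)
open import Data.Vec using ([]; _∷_)
open import Data.Fin using (Fin)
open import Data.Fin.Subset using (Subset; ∁)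
open import Data.Sum using (_⊎_; inj₁; inj₂; [_,_]′)
import Data.Sum as Sum
open import Data.Product using (_,_; proj₂)
open import Data.Empty using (⊥-elim)
open import Function using (id; _∘_; _⇔_; _↔_; Equivalence)
import Function.Properties.Equivalence as ⇔
open import Relation.Nullary using (yes; no; contraposition)
open import Relation.Binary.Core using (Rel)
open import Relation.Binary.Definitions using (_Respects_)
open import Relation.Binary.PropositionalEquality
  using (_≡_; _≢_; refl; sym; trans; cong; ≢-sym)
open import Relation.Binary.Construct.Closure.ReflexiveTransitive using (Star; ε; _◅_)

open Equivalence using (to; from)

respects-Star : ∀ {A : Set} {ℓ} {R : Rel A ℓ} {P : A → Set} → P Respects R → P Respects Star R
respects-Star resp ε        = id
respects-Star resp (r ◅ rs) = respects-Star resp rs ∘ resp r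

Flat : ∀ {k} → Subset k → ℕ → Set
Flat S j = desAt S j ≡ desAt S (suc j)

SameFlats : ∀ {k} → Subset k → Subset k → Set
SameFlats {k} S T = ∀ j → suc (suc j) ≤ k → Flat S (suc j) ⇔ Flat T (suc j)

≡-from-⇔ : ∀ {x y z : Bool} → (x ≡ z ⇔ y ≡ z) → y ≡ x
≡-from-⇔ {false} {_} {false} e = to e refl
≡-from-⇔ {true}  {_} {true}  e = to e refl
≡-from-⇔ {false} {_} {true}  e = ¬-not (contraposition (from e) λ ())
≡-from-⇔ {true}  {_} {false} e = ¬-not (contraposition (from e) λ ())

≡-not-from-⇔ : ∀ {x y z : Bool} → (x ≡ z ⇔ y ≡ not z) → y ≡ not x
≡-not-from-⇔ {false} {_} {false} e = to e refl
≡-not-from-⇔ {true}  {_} {true}  e = to e refl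
≡-not-from-⇔ {false} {_} {true}  e = ¬-not (contraposition (from e) λ ())
≡-not-from-⇔ {true}  {_} {false} e = ¬-not (contraposition (from e) λ ())

sameFlats⇒≡⊎≡∁ : ∀ {k} {S T : Subset k} → SameFlats S T → T ≡ S ⊎ T ≡ ∁ S
sameFlats⇒≡⊎≡∁ {S = []} {[]} _ = inj₁ refl
sameFlats⇒≡⊎≡∁ {S = x ∷ []} {y ∷ []} _ with y ≟ x
... | yes refl = inj₁ refl
... | no y≢x   = inj₂ (cong (_∷ []) (¬-not y≢x))
sameFlats⇒≡⊎≡∁ {S = x ∷ x′ ∷ S} {y ∷ y′ ∷ T} same
  with sameFlats⇒≡⊎≡∁ {S = x′ ∷ S} {y′ ∷ T} (λ j → same (suc j) ∘ s≤s)
... | inj₁ refl = inj₁ (cong (_∷ _) (≡-from-⇔ (same 0 (s≤s (s≤s z≤n)))))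
... | inj₂ refl = inj₂ (cong (_∷ _) (≡-not-from-⇔ (same 0 (s≤s (s≤s z≤n)))))

desAt-∁ : ∀ {k} (S : Subset k) {j} → j < k → desAt (∁ S) (suc j) ≡ not (desAt S (suc j))
desAt-∁ (x ∷ S) {zero}  _         = refl
desAt-∁ (x ∷ S) {suc j} (s≤s j<k) = desAt-∁ S j<k

≡-and-≡∁-incompatible-at-flip : ∀ {k} {S T S′ T′ : Subset k} {j} → j < k →
  desAt S (suc j) ≢ desAt T (suc j) → desAt S′ (suc j) ≢ desAt T′ (suc j) →
  S′ ≡ S → T′ ≢ ∁ T
≡-and-≡∁-incompatible-at-flip {T = T} j<k S≢T S′≢T′ refl refl =
  S′≢T′ (trans (¬-not S≢T) (sym (desAt-∁ T j<k)))

colour : ∀ {C : Set} {n j} {φ : ℕ → C → C} → suc (suc j) ≤ n ∸ 1 → Colour n φ (suc (suc j))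
colour {n = suc n} le = s≤s (s≤s z≤n) , s≤s le

module _ {C : Set} {n : ℕ} {φ : ℕ → C → C} (D D′ : C → Subset (n ∸ 1))
         (iD : CondI n φ D) (iD′ : CondI n φ D′) where

  sameFlats : ∀ c → SameFlats (D c) (D′ c)
  sameFlats c j le = ⇔.trans (⇔.sym (iD _ (colour {φ = φ} le) c)) (iD′ _ (colour {φ = φ} le) c)

  ≡⊎≡∁ : ∀ c → D′ c ≡ D c ⊎ D′ c ≡ ∁ (D c)
  ≡⊎≡∁ c = sameFlats⇒≡⊎≡∁ (sameFlats c)

  module _ (iibD : CondIIb n φ D) (iibD′ : CondIIb n φ D′) where

    ≡-preserved : ∀ {c d} → Edge n φ c d → D′ c ≡ D c → D′ d ≡ D d
    ≡-preserved {c} (_ , col@(s≤s (s≤s _) , i<n) , refl , c≢d) D′c≡Dc =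
      [ id , ⊥-elim ∘ ≡-and-≡∁-incompatible-at-flip (∸-monoˡ-≤ 1 i<n)
               (proj₂ (iibD _ col c c≢d)) (proj₂ (iibD′ _ col c c≢d)) D′c≡Dc ]′
      (≡⊎≡∁ _)

    ∁-preserved : ∀ {c d} → Edge n φ c d → D′ c ≡ ∁ (D c) → D′ d ≡ ∁ (D d)
    ∁-preserved {c} (_ , col@(s≤s (s≤s _) , i<n) , refl , c≢d) D′c≡∁Dc =
      [ (λ D′d≡Dd → ⊥-elim (≡-and-≡∁-incompatible-at-flip (∸-monoˡ-≤ 1 i<n)
          (≢-sym (proj₂ (iibD _ col c c≢d))) (≢-sym (proj₂ (iibD′ _ col c c≢d)))
          D′d≡Dd D′c≡∁Dc)) , id ]′
      (≡⊎≡∁ _)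

lemma1p9 : (n : ℕ) → 1 ≤ n →
    (C : Set) → (m : ℕ) → Fin m ↔ C →
    (φ : ℕ → C → C) → Involutions n φ →
    (D D′ : C → Subset (n ∸ 1)) →
    CondI n φ D → CondIIb n φ D →
    CondI n φ D′ → CondIIb n φ D′ →
    (c₀ : C) →
    (∀ c → Connected n φ c₀ c → D′ c ≡ D c) ⊎
    (∀ c → Connected n φ c₀ c → D′ c ≡ ∁ (D c))
lemma1p9 n _ C _ _ φ _ D D′ iD iibD iD′ iibD′ c₀ =
  Sum.map (λ e c p → respects-Star (≡-preserved D D′ iD iD′ iibD iibD′) p e)
          (λ e c p → respects-Star (∁-preserved D D′ iD iD′ iibD iibD′) p e)
          (≡⊎≡∁ D D′ iD iD′ c₀)
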